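{- Let $G$ be a square and let $H$ be any graph. Then the Cartesian product $G\,\Box\, H$ is a square.
   Context: $G\,\Box\,H$ has vertex set $V(G)\times V(H)$, with $(g,h)$ adjacent to $(g',h')$ iff either $g=g'$ and $hh'\in E(H)$, or $h=h'$ and $gg'\in E(G)$. All graphs are finite, simple, with nonempty vertex sets. A partially labeled graph is a graph $K$ together with an injective map $\theta: L\to V(K)$, $L\subseteq\mathbb{N}$, whose image $\theta(L)$ is nonempty and a proper subset of $V(K)$; vertices in $\theta(L)$ are labeled. The square $KK$ is obtained from two disjoint copies of $K$ by identifying each labeled vertex $\theta(\ell)$ of the first copy with $\theta(\ell)$ of the second copy (keeping all edges, merging double edges). A graph is a square if it is isomorphic to $KK$ for some partially labeled graph $K$. -}

module Defs where

open import Data.Nat using (ℕ; _*_)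
open import Data.Fin using (Fin)
open import Data.Fin.Properties using (*↔×)
open import Data.Bool using (Bool; true; false)
open import Data.Unit using (⊤)
open import Data.Product using (Σ; ∃; _×_; _,_; proj₁; proj₂)
open import Data.Product.Function.NonDependent.Propositional using (_×-cong_)
open import Data.Sum using (_⊎_; inj₁; inj₂; [_,_])
open import Relation.Nullary using (¬_)
open import Relation.Binary.PropositionalEquality using (_≡_; refl; sym)
open import Function.Bundles using (_↔_; _⇔_; Inverse)
open import Function.Properties.Inverse using (↔-sym; ↔-trans)

record Graph : Set₁ where
  field
    V         : Set
    E         : V → V → Set
    E-sym     : ∀ {u v} → E u v → E v u
    E-irrefl  : ∀ {v} → ¬ E v v
    finite    : Σ ℕ (λ n → V ↔ Fin n)
    inhabited : V
open Graph public

IsoTo : (G : Graph) (W : Set) (R : W → W → Set) → Set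
IsoTo G W R = Σ (V G ↔ W) λ f →
  ∀ u v → E G u v ⇔ R (Inverse.to f u) (Inverse.to f v)

□-E : (G H : Graph) → V G × V H → V G × V H → Set
□-E G H (g , h) (g' , h') = (g ≡ g' × E H h h') ⊎ (h ≡ h' × E G g g')

□-sym : (G H : Graph) → ∀ {x y} → □-E G H x y → □-E G H y x
□-sym G H (inj₁ (refl , e)) = inj₁ (refl , E-sym H e)
□-sym G H (inj₂ (refl , e)) = inj₂ (refl , E-sym G e)

□-irrefl : (G H : Graph) → ∀ {x} → ¬ □-E G H x x
□-irrefl G H (inj₁ (_ , e)) = E-irrefl H e
□-irrefl G H (inj₂ (_ , e)) = E-irrefl G e

_□_ : Graph → Graph → Graph
G □ H = record
  { V         = V G × V H
  ; E         = □-E G H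
  ; E-sym     = □-sym G H
  ; E-irrefl  = □-irrefl G H
  ; finite    = proj₁ (finite G) * proj₁ (finite H)
              , ↔-trans (proj₂ (finite G) ×-cong proj₂ (finite H)) (↔-sym *↔×)
  ; inhabited = inhabited G , inhabited H
  }

-- Only the image θ(L) of the labelling
-- matters for the square construction, so a partially labeled graph is
-- recorded as a graph K with a predicate `lab` marking the labeled
-- vertices, such that the labeled set is nonempty and a proper subset.

record PLGraph : Set₁ where
  field
    K         : Graph
    lab       : V K → Bool
    someLab   : ∃ λ v → lab v ≡ true
    someUnlab : ∃ λ v → lab v ≡ false
open PLGraph public

-- Vertices of KK: each labeled vertex once (shared by both copies),
-- each unlabeled vertex once per copy (copies indexed by Bool).
SqV : PLGraph → Set
SqV P = (Σ (V (K P)) λ v → lab P v ≡ true)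
      ⊎ (Bool × Σ (V (K P)) λ v → lab P v ≡ false)

und : (P : PLGraph) → SqV P → V (K P)
und P (inj₁ (v , _))     = v
und P (inj₂ (_ , v , _)) = v

InCopy : (P : PLGraph) → Bool → SqV P → Set
InCopy P c (inj₁ _)            = ⊤
InCopy P c (inj₂ (c' , _))     = c ≡ c'

-- Edges of KK: x ~ y iff they lie in a common copy and the underlying
-- vertices are adjacent in K (double edges merged).
SqE : (P : PLGraph) → SqV P → SqV P → Set
SqE P x y = E (K P) (und P x) (und P y)
          × Σ Bool (λ c → InCopy P c x × InCopy P c y)

IsSquare : Graph → Set₁
IsSquare G = Σ PLGraph λ P → IsoTo G (SqV P) (SqE P)

{-# OPTIONS --safe #-}

-- If G ≅ KK, then G □ H ≅ (KK) □ H, and (KK) □ H is itself the square of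
-- K □ H, labeled at (k , h) exactly when k is labeled in K: a vertex
-- (x , h) of KK □ H is shared by both copies iff x is, and every edge of
-- KK □ H lies in one copy of K □ H, because an H-edge joins two vertices
-- over the same x, and a KK-edge lies in one copy of K.

module Submission where

open import Defs
open import Level using (0ℓ)
open import Data.Bool using (Bool; true)
open import Data.Bool.Properties using (_≟_)
open import Data.Unit using (tt)
open import Data.Product using (Σ; _×_; _,_; proj₁; proj₂)
open import Data.Sum using (_⊎_; inj₁; inj₂)
open import Relation.Binary.Core using (Rel)
open import Relation.Binary.PropositionalEquality
  using (_≡_; refl; sym; trans; cong; subst)
open import Axiom.UniquenessOfIdentityProofs using (module Decidable⇒UIP)
open import Function.Bundles using (_↔_; _⇔_; Inverse; Equivalence; Injection; mk⇔; mk↔ₛ′)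
open import Function.Properties.Inverse using (↔-trans; ↔⇒↣)
open import Function.Construct.Composition using (_⇔-∘_)

private
  variable
    A B C : Set

-- IsoTo G W R and □-E G H are, by definition, RelIso (E G) R and E G □ᴿ E H.
RelIso : Rel A 0ℓ → Rel B 0ℓ → Set
RelIso {A} {B} R S = Σ (A ↔ B) λ f → ∀ u v → R u v ⇔ S (Inverse.to f u) (Inverse.to f v)

RelIso-trans : {R : Rel A 0ℓ} {S : Rel B 0ℓ} {T : Rel C 0ℓ} →
               RelIso R S → RelIso S T → RelIso R T
RelIso-trans (f , R⇔S) (g , S⇔T) =
  ↔-trans f g , λ u v → S⇔T (Inverse.to f u) (Inverse.to f v) ⇔-∘ R⇔S u v

_□ᴿ_ : Rel A 0ℓ → Rel B 0ℓ → Rel (A × B) 0ℓ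
(R □ᴿ S) (a , b) (a' , b') = (a ≡ a' × S b b') ⊎ (b ≡ b' × R a a')

RelIso-□ʳ : {R : Rel A 0ℓ} {S : Rel B 0ℓ} → RelIso R S →
            (T : Rel C 0ℓ) → RelIso (R □ᴿ T) (S □ᴿ T)
RelIso-□ʳ {A} {B} {C} {R} {S} (f , R⇔S) T = f×id , edges
  where
  open Inverse f using (to; from; strictlyInverseˡ; strictlyInverseʳ)

  f×id : (A × C) ↔ (B × C)
  f×id = mk↔ₛ′ (λ (a , c) → to a , c) (λ (b , c) → from b , c)
               (λ (b , c) → cong (_, c) (strictlyInverseˡ b))
               (λ (a , c) → cong (_, c) (strictlyInverseʳ a))

  edges : ∀ u v → (R □ᴿ T) u v ⇔ (S □ᴿ T) (Inverse.to f×id u) (Inverse.to f×id v)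
  edges (a , c) (a' , c') = mk⇔ forth back
    where
    forth : (R □ᴿ T) (a , c) (a' , c') → (S □ᴿ T) (to a , c) (to a' , c')
    forth (inj₁ (a≡a' , t)) = inj₁ (cong to a≡a' , t)
    forth (inj₂ (c≡c' , r)) = inj₂ (c≡c' , Equivalence.to (R⇔S a a') r)

    back : (S □ᴿ T) (to a , c) (to a' , c') → (R □ᴿ T) (a , c) (a' , c')
    back (inj₁ (fa≡fa' , t)) = inj₁ (Injection.injective (↔⇒↣ f) fa≡fa' , t)
    back (inj₂ (c≡c' , s))   = inj₂ (c≡c' , Equivalence.from (R⇔S a a') s)

_□ᴾ_ : PLGraph → Graph → PLGraph
P □ᴾ H = record
  { K         = K P □ H
  ; lab       = λ (k , _) → lab P k
  ; someLab   = (proj₁ (someLab P) , inhabited H) , proj₂ (someLab P)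
  ; someUnlab = (proj₁ (someUnlab P) , inhabited H) , proj₂ (someUnlab P)
  }

module _ (P : PLGraph) where

  CommonCopy : Rel (SqV P) 0ℓ
  CommonCopy x y = Σ Bool λ c → InCopy P c x × InCopy P c y

  CommonCopy-refl : ∀ x → CommonCopy x x
  CommonCopy-refl (inj₁ _)       = true , tt , tt
  CommonCopy-refl (inj₂ (c , _)) = c , refl , refl

  und-injective-within-copy : ∀ {x y} → CommonCopy x y → und P x ≡ und P y → x ≡ y
  und-injective-within-copy {inj₁ (k , p)} {inj₁ (.k , q)} _ refl =
    cong (λ r → inj₁ (k , r)) (Decidable⇒UIP.≡-irrelevant _≟_ p q)
  und-injective-within-copy {inj₁ (k , p)} {inj₂ (_ , .k , q)} _ refl
    with trans (sym p) q
  ... | ()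
  und-injective-within-copy {inj₂ (_ , k , p)} {inj₁ (.k , q)} _ refl
    with trans (sym q) p
  ... | ()
  und-injective-within-copy {inj₂ (c , k , p)} {inj₂ (.c , .k , q)} (.c , refl , refl) refl =
    cong (λ r → inj₂ (c , k , r)) (Decidable⇒UIP.≡-irrelevant _≟_ p q)

module _ (P : PLGraph) (H : Graph) where

  pairSq : SqV P × V H → SqV (P □ᴾ H)
  pairSq (inj₁ (k , p) , h)     = inj₁ ((k , h) , p)
  pairSq (inj₂ (c , k , p) , h) = inj₂ (c , (k , h) , p)

  unpairSq : SqV (P □ᴾ H) → SqV P × V H
  unpairSq (inj₁ ((k , h) , p))     = inj₁ (k , p) , h
  unpairSq (inj₂ (c , (k , h) , p)) = inj₂ (c , k , p) , h

  SqV-□ᴾ : (SqV P × V H) ↔ SqV (P □ᴾ H)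
  SqV-□ᴾ = mk↔ₛ′ pairSq unpairSq pair∘unpair unpair∘pair
    where
    pair∘unpair : ∀ z → pairSq (unpairSq z) ≡ z
    pair∘unpair (inj₁ _) = refl
    pair∘unpair (inj₂ _) = refl

    unpair∘pair : ∀ z → unpairSq (pairSq z) ≡ z
    unpair∘pair (inj₁ _ , _) = refl
    unpair∘pair (inj₂ _ , _) = refl

  SqE-pairSq : ∀ x y h h' → SqE (P □ᴾ H) (pairSq (x , h)) (pairSq (y , h'))
             ≡ (□-E (K P) H (und P x , h) (und P y , h') × CommonCopy P x y)
  SqE-pairSq (inj₁ _) (inj₁ _) _ _ = refl
  SqE-pairSq (inj₁ _) (inj₂ _) _ _ = refl
  SqE-pairSq (inj₂ _) (inj₁ _) _ _ = refl
  SqE-pairSq (inj₂ _) (inj₂ _) _ _ = refl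

  SqE-□ᴿ⇔ : ∀ x y h h' → (SqE P □ᴿ E H) (x , h) (y , h')
          ⇔ (□-E (K P) H (und P x , h) (und P y , h') × CommonCopy P x y)
  SqE-□ᴿ⇔ x y h h' = mk⇔ forth back
    where
    forth : (SqE P □ᴿ E H) (x , h) (y , h') →
            □-E (K P) H (und P x , h) (und P y , h') × CommonCopy P x y
    forth (inj₁ (refl , e))      = inj₁ (refl , e) , CommonCopy-refl P x
    forth (inj₂ (refl , e , xy)) = inj₂ (refl , e) , xy

    back : □-E (K P) H (und P x , h) (und P y , h') × CommonCopy P x y →
           (SqE P □ᴿ E H) (x , h) (y , h')
    back (inj₁ (same-und , e) , xy) = inj₁ (und-injective-within-copy P xy same-und , e)
    back (inj₂ (h≡h' , e) , xy)     = inj₂ (h≡h' , e , xy)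

  square-□ᴾ : RelIso (SqE P □ᴿ E H) (SqE (P □ᴾ H))
  square-□ᴾ = SqV-□ᴾ , λ (x , h) (y , h') →
    subst ((SqE P □ᴿ E H) (x , h) (y , h') ⇔_) (sym (SqE-pairSq x y h h')) (SqE-□ᴿ⇔ x y h h')

theorem5p2 : (G H : Graph) → IsSquare G → IsSquare (G □ H)
theorem5p2 G H (P , G≅KK) =
  P □ᴾ H , RelIso-trans {T = SqE (P □ᴾ H)} G□H≅KK□H (square-□ᴾ P H)
  where
  G□H≅KK□H : RelIso (E G □ᴿ E H) (SqE P □ᴿ E H)
  G□H≅KK□H = RelIso-□ʳ {S = SqE P} G≅KK (E H)
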